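{- Let $n\ge 3$ and $j\in[[n]]$, and let $G^j$ be the subgraph of $BP_n$ induced by the vertices whose last entry is $j$. If $x$ is a vertex of $G^j$, then for every $1\le i\le n-1$ the graph $G^j\setminus\{x, x(i)\}$ (obtained from $G^j$ by deleting $x$ and $x(i)$ together with their incident edges) is connected.
   Context: Notation: $[n]=\{1,\dots,n\}$, $\bar{i}=-i$, and $[[n]] = [n]\cup\{\bar i : i\in[n]\}$. A signed permutation of $[n]$ is a sequence $x = x_1x_2\cdots x_n$ of elements of $[[n]]$ such that $|x_1||x_2|\cdots|x_n|$ is a permutation of $[n]$. For $1\le i\le n$, the $i$-th signed prefix reversal of $x$ is $x(i) = \bar{x}_i\bar{x}_{i-1}\cdots\bar{x}_1x_{i+1}\cdots x_n$. The $n$-dimensional burnt pancake graph $BP_n$ is the simple graph whose vertices are all signed permutations of $[n]$, with $x$ and $y$ adjacent if and only if $y = x(i)$ for some $i\in[n]$. For $i\in[[n]]$, the cluster $G^i$ is the subgraph of $BP_n$ induced by the vertices $x$ with $x_n = i$ (note that $x(i)\in V(G^j)$ whenever $x\in V(G^j)$ and $i\le n-1$). -}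

module Defs where

open import Data.Bool using (Bool; true; false; not)
open import Data.Nat using (ℕ; suc; _≤_; _∸_)
open import Data.Fin using (Fin)
open import Data.List using (List; []; _∷_; map; reverse; take; drop; _++_; length; allFin; last)
open import Data.Maybe using (just)
open import Data.Product using (_×_; _,_; proj₁; proj₂; Σ; ∃)
open import Relation.Binary.PropositionalEquality using (_≡_)
open import Relation.Nullary using (¬_)
open import Data.List.Relation.Binary.Permutation.Propositional using (_↭_)

-- An element of [[n]]: (b , a) stands for a+1 if b = false and for the
-- barred element -(a+1) if b = true  (Fin n = {0..n-1} encodes [n]).
Signed : ℕ → Set
Signed n = Bool × Fin n

bar : ∀ {n} → Signed n → Signed n
bar (b , a) = (not b , a)

∣_∣ˢ : ∀ {n} → Signed n → Fin n
∣ s ∣ˢ = proj₂ s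

IsSignedPerm : (n : ℕ) → List (Signed n) → Set
IsSignedPerm n x = map ∣_∣ˢ x ↭ allFin n

prefixRev : ∀ {n} → ℕ → List (Signed n) → List (Signed n)
prefixRev i x = map bar (reverse (take i x)) ++ drop i x

Adj : (n : ℕ) → List (Signed n) → List (Signed n) → Set
Adj n x y = Σ ℕ λ i → (1 ≤ i) × (i ≤ n) × (y ≡ prefixRev i x)

InCluster : (n : ℕ) → Signed n → List (Signed n) → Set
InCluster n j x = IsSignedPerm n x × (last x ≡ just j)

data Walk (n : ℕ) (P : List (Signed n) → Set) : List (Signed n) → List (Signed n) → Set where
  done : ∀ {u} → Walk n P u u
  step : ∀ {u v w} → Adj n u v → P v → Walk n P v w → Walk n P u w

InducedConnected : (n : ℕ) → (List (Signed n) → Set) → Set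
InducedConnected n P = ∀ u v → P u → P v → Walk n P u v

ClusterMinus : (n : ℕ) → Signed n → List (Signed n) → ℕ → List (Signed n) → Set
ClusterMinus n j x i y = InCluster n j y × ¬ (y ≡ x) × ¬ (y ≡ prefixRev i x)

-- Prefix reversals x(i) with i ≤ n − 1 fix the last entry, so G^j is a copy of the burnt
-- pancake graph on the n − 1 remaining absolute values, and it suffices to show that BP on
-- an alphabet of m ≥ 2 letters stays connected after deleting c and d = c(i).  Call a letter
-- clean if neither c nor d ends with it.  A cluster with a clean last letter f avoids c and d
-- and is a copy of BP on m − 1 letters, hence connected by induction.  Two such clusters f, g
-- with |f| ≠ |g| are joined by one full flip from a vertex ḡ y f; if |f| = |g| one passes
-- through a third clean cluster.  Every remaining vertex a r reaches a clean cluster by the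
-- full flip, or, when ā is not clean, by first flipping a: then a is clean (no letter and its
-- bar both end c or d), and ā r is not deleted since c and d start with clean letters.

module Submission where

open import Defs
open import Data.Bool using (true; false)
import Data.Bool as Bool
open import Data.Empty using (⊥-elim)
open import Data.Fin using (Fin)
import Data.Fin.Properties as Fin
open import Data.List
  using (List; []; _∷_; _∷ʳ_; [_]; _++_; map; reverse; length; take; drop; head; last; allFin;
         initLast; _∷ʳ′_)
open import Data.List.Properties
  using (map-++; map-∘; map-id; map-cong; length-map; length-reverse; length-++-≤ˡ; length-tabulate;
         ++-assoc; ++-identityʳ; reverse-++; unfold-reverse; reverse-map; reverse-involutive;
         take++drop≡id; ∷ʳ-injectiveˡ)
open import Data.List.Membership.Propositional using (_∈_)
open import Data.List.Membership.Propositional.Properties using (∈-∃++; ∈-++⁻; ∈-++⁺ʳ; ∈-map⁺)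
open import Data.List.Relation.Unary.Any using (here)
open import Data.List.Relation.Unary.Unique.Propositional using (Unique)
import Data.List.Relation.Unary.Unique.Propositional.Properties as Unique
open import Data.List.Relation.Binary.Permutation.Propositional
  using (_↭_; ↭-refl; ↭-reflexive; ↭-sym; ↭-trans; ↭⇒↭ₛ; module PermutationReasoning)
open import Data.List.Relation.Binary.Permutation.Propositional.Properties
  using (↭-length; ++⁺ʳ; ↭-reverse; drop-∷; ∷↭∷ʳ; shift; ∈-resp-↭; ↭-singleton-inv)
import Data.List.Relation.Binary.Permutation.Setoid.Properties as Permutationₛ
open import Data.Maybe using (Maybe; just)
import Data.Maybe.Properties as Maybe
open import Data.Maybe.Properties using (just-injective)
open import Data.Nat using (ℕ; zero; suc; _≤_; _∸_; z≤n; s≤s; s≤s⁻¹)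
open import Data.Nat.Properties using (≤-refl; ≤-trans; ≤-reflexive; suc-injective; m≤n⇒m<n∨m≡n)
open import Data.Product using (_×_; _,_; proj₁; proj₂; ∃; ∃₂)
import Data.Product.Properties as Product
open import Data.Sum using (_⊎_; inj₁; inj₂)
open import Function using (id)
open import Relation.Binary.PropositionalEquality hiding ([_])
open import Relation.Nullary using (¬_; yes; no; Dec)
open import Relation.Nullary.Decidable using (_⊎-dec_)

take-length-++ : ∀ {A : Set} (xs ys : List A) → take (length xs) (xs ++ ys) ≡ xs
take-length-++ []       ys = refl
take-length-++ (x ∷ xs) ys = cong (x ∷_) (take-length-++ xs ys)

drop-length-++ : ∀ {A : Set} (xs ys : List A) → drop (length xs) (xs ++ ys) ≡ ys
drop-length-++ []       ys = refl
drop-length-++ (x ∷ xs) ys = drop-length-++ xs ys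

split-at : ∀ {A : Set} i (w : List A) → i ≤ length w → ∃₂ λ t d → w ≡ t ++ d × length t ≡ i
split-at zero    w       _         = [] , w , refl , refl
split-at (suc i) (x ∷ w) (s≤s i≤w) with t , d , refl , refl ← split-at i w i≤w =
  x ∷ t , d , refl , refl

length-∷ʳ : ∀ {A : Set} (w : List A) x → length (w ∷ʳ x) ≡ suc (length w)
length-∷ʳ []      x = refl
length-∷ʳ (_ ∷ w) x = cong suc (length-∷ʳ w x)

last-∷ʳ : ∀ {A : Set} (w : List A) x → last (w ∷ʳ x) ≡ just x
last-∷ʳ []          x = refl
last-∷ʳ (_ ∷ [])    x = refl
last-∷ʳ (_ ∷ y ∷ w) x = last-∷ʳ (y ∷ w) x

last-∷ʳ⁻ : ∀ {A : Set} (w : List A) {x y} → last (w ∷ʳ x) ≡ just y → y ≡ x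
last-∷ʳ⁻ w {x} last≡y = sym (just-injective (trans (sym (last-∷ʳ w x)) last≡y))

module _ {n : ℕ} where

  private
    Letter : Set
    Letter = Signed n

  bar-involutive : (s : Letter) → bar (bar s) ≡ s
  bar-involutive (false , _) = refl
  bar-involutive (true  , _) = refl

  bar≢ : (s : Letter) → bar s ≢ s
  bar≢ (false , _) ()
  bar≢ (true  , _) ()

  ∣∣≡⇒≡⊎≡bar : {s t : Letter} → ∣ s ∣ˢ ≡ ∣ t ∣ˢ → t ≡ s ⊎ t ≡ bar s
  ∣∣≡⇒≡⊎≡bar {false , _} {false , _} refl = inj₁ refl
  ∣∣≡⇒≡⊎≡bar {false , _} {true  , _} refl = inj₂ refl
  ∣∣≡⇒≡⊎≡bar {true  , _} {false , _} refl = inj₂ refl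
  ∣∣≡⇒≡⊎≡bar {true  , _} {true  , _} refl = inj₁ refl

  flipped : List Letter → List Letter
  flipped w = map bar (reverse w)

  flipped-involutive : (w : List Letter) → flipped (flipped w) ≡ w
  flipped-involutive w = begin
    map bar (reverse (map bar (reverse w)))       ≡⟨ cong (map bar) (reverse-map bar (reverse w)) ⟨
    map bar (map bar (reverse (reverse w)))       ≡⟨ map-∘ (reverse (reverse w)) ⟨
    map (λ s → bar (bar s)) (reverse (reverse w)) ≡⟨ map-cong bar-involutive (reverse (reverse w)) ⟩
    map id (reverse (reverse w))                  ≡⟨ map-id (reverse (reverse w)) ⟩
    reverse (reverse w)                           ≡⟨ reverse-involutive w ⟩
    w                                             ∎
    where open ≡-Reasoning

  flipped-∷ : (a : Letter) (w : List Letter) → flipped (a ∷ w) ≡ flipped w ∷ʳ bar a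
  flipped-∷ a w = trans (cong (map bar) (unfold-reverse a w)) (map-++ bar (reverse w) [ a ])

  length-flipped : (w : List Letter) → length (flipped w) ≡ length w
  length-flipped w = trans (length-map bar (reverse w)) (length-reverse w)

  ∣flipped∣↭ : (w : List Letter) → map ∣_∣ˢ (flipped w) ↭ map ∣_∣ˢ w
  ∣flipped∣↭ w = begin
    map ∣_∣ˢ (map bar (reverse w)) ≡⟨ map-∘ (reverse w) ⟨
    map ∣_∣ˢ (reverse w)           ≡⟨ reverse-map ∣_∣ˢ w ⟩
    reverse (map ∣_∣ˢ w)           ↭⟨ ↭-reverse (map ∣_∣ˢ w) ⟩
    map ∣_∣ˢ w                     ∎
    where open PermutationReasoning

  prefixRev-++ : (t d : List Letter) → prefixRev (length t) (t ++ d) ≡ flipped t ++ d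
  prefixRev-++ t d = cong₂ (λ t′ d′ → flipped t′ ++ d′) (take-length-++ t d) (drop-length-++ t d)

  prefixRev-all : (w : List Letter) → prefixRev (length w) w ≡ flipped w
  prefixRev-all w = begin
    prefixRev (length w) w        ≡⟨ cong (λ v → prefixRev (length w) v) (++-identityʳ w) ⟨
    prefixRev (length w) (w ++ []) ≡⟨ prefixRev-++ w [] ⟩
    flipped w ++ []               ≡⟨ ++-identityʳ (flipped w) ⟩
    flipped w                     ∎
    where open ≡-Reasoning

  prefixRev-∷ʳ : ∀ i (w : List Letter) f → i ≤ length w → prefixRev i (w ∷ʳ f) ≡ prefixRev i w ∷ʳ f
  prefixRev-∷ʳ i w f i≤∣w∣ with t , d , refl , refl ← split-at i w i≤∣w∣ = begin
    prefixRev (length t) ((t ++ d) ∷ʳ f) ≡⟨ cong (prefixRev (length t)) (++-assoc t d [ f ]) ⟩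
    prefixRev (length t) (t ++ d ∷ʳ f)   ≡⟨ prefixRev-++ t (d ∷ʳ f) ⟩
    flipped t ++ d ∷ʳ f                  ≡⟨ ++-assoc (flipped t) d [ f ] ⟨
    (flipped t ++ d) ∷ʳ f                ≡⟨ cong (_∷ʳ f) (prefixRev-++ t d) ⟨
    prefixRev (length t) (t ++ d) ∷ʳ f   ∎
    where open ≡-Reasoning

  prefixRev-involutive : ∀ i (w : List Letter) → i ≤ length w → prefixRev i (prefixRev i w) ≡ w
  prefixRev-involutive i w i≤∣w∣ with t , d , refl , refl ← split-at i w i≤∣w∣ = begin
    prefixRev (length t) (prefixRev (length t) (t ++ d))
      ≡⟨ cong (prefixRev (length t)) (prefixRev-++ t d) ⟩
    prefixRev (length t) (flipped t ++ d)
      ≡⟨ cong (λ m → prefixRev m (flipped t ++ d)) (length-flipped t) ⟨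
    prefixRev (length (flipped t)) (flipped t ++ d)
      ≡⟨ prefixRev-++ (flipped t) d ⟩
    flipped (flipped t) ++ d
      ≡⟨ cong (_++ d) (flipped-involutive t) ⟩
    t ++ d
      ∎
    where open ≡-Reasoning

  ∣prefixRev∣↭ : ∀ i (w : List Letter) → map ∣_∣ˢ (prefixRev i w) ↭ map ∣_∣ˢ w
  ∣prefixRev∣↭ i w = begin
    map ∣_∣ˢ (flipped t ++ d)         ≡⟨ map-++ ∣_∣ˢ (flipped t) d ⟩
    map ∣_∣ˢ (flipped t) ++ map ∣_∣ˢ d ↭⟨ ++⁺ʳ (map ∣_∣ˢ d) (∣flipped∣↭ t) ⟩
    map ∣_∣ˢ t ++ map ∣_∣ˢ d          ≡⟨ map-++ ∣_∣ˢ t d ⟨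
    map ∣_∣ˢ (t ++ d)                 ≡⟨ cong (map ∣_∣ˢ) (take++drop≡id i w) ⟩
    map ∣_∣ˢ w                        ∎
    where open PermutationReasoning
          t d : List Letter
          t = take i w
          d = drop i w

  length-prefixRev : ∀ i (w : List Letter) → length (prefixRev i w) ≡ length w
  length-prefixRev i w = begin
    length (prefixRev i w)            ≡⟨ length-map ∣_∣ˢ (prefixRev i w) ⟨
    length (map ∣_∣ˢ (prefixRev i w)) ≡⟨ ↭-length (∣prefixRev∣↭ i w) ⟩
    length (map ∣_∣ˢ w)               ≡⟨ length-map ∣_∣ˢ w ⟩
    length w                          ∎
    where open ≡-Reasoning

  infix 4 _∈BP_

  -- Vertices of BP on a duplicate-free list A of absolute values; BP_n is A = allFin n.
  record _∈BP_ (w : List Letter) (A : List (Fin n)) : Set where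
    constructor abs↭
    field ∣w∣↭A : map ∣_∣ˢ w ↭ A

  ∈BP-prefixRev : ∀ {A} i {w} → w ∈BP A → prefixRev i w ∈BP A
  ∈BP-prefixRev i {w} (abs↭ w∈) = abs↭ (↭-trans (∣prefixRev∣↭ i w) w∈)

  ∈BP-length : ∀ {A w} → w ∈BP A → length w ≡ length A
  ∈BP-length {A} {w} (abs↭ w∈) = trans (sym (length-map ∣_∣ˢ w)) (↭-length w∈)

  ∈BP-unique : ∀ {A w} → w ∈BP A → Unique A → Unique (map ∣_∣ˢ w)
  ∈BP-unique (abs↭ w∈) = Permutationₛ.Unique-resp-↭ (setoid (Fin n)) (↭⇒↭ₛ (↭-sym w∈))

  ∈BP-∷ʳ⁻ : ∀ {A w v f} → w ∷ʳ f ∈BP A → v ∷ʳ f ∈BP A → v ∈BP map ∣_∣ˢ w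
  ∈BP-∷ʳ⁻ {A} {w} {v} {f} (abs↭ w∈) (abs↭ v∈) = abs↭ (drop-∷ (begin
    ∣ f ∣ˢ ∷ map ∣_∣ˢ v    ↭⟨ ∷↭∷ʳ ∣ f ∣ˢ (map ∣_∣ˢ v) ⟩
    map ∣_∣ˢ v ∷ʳ ∣ f ∣ˢ   ≡⟨ map-++ ∣_∣ˢ v [ f ] ⟨
    map ∣_∣ˢ (v ∷ʳ f)      ↭⟨ v∈ ⟩
    A                      ↭⟨ w∈ ⟨
    map ∣_∣ˢ (w ∷ʳ f)      ≡⟨ map-++ ∣_∣ˢ w [ f ] ⟩
    map ∣_∣ˢ w ∷ʳ ∣ f ∣ˢ   ↭⟨ ∷↭∷ʳ ∣ f ∣ˢ (map ∣_∣ˢ w) ⟨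
    ∣ f ∣ˢ ∷ map ∣_∣ˢ w    ∎))
    where open PermutationReasoning

  ∈BP-∷ʳ⁺ : ∀ {A w v f} → v ∈BP map ∣_∣ˢ w → w ∷ʳ f ∈BP A → v ∷ʳ f ∈BP A
  ∈BP-∷ʳ⁺ {A} {w} {v} {f} (abs↭ v∈) (abs↭ w∈) = abs↭ (begin
    map ∣_∣ˢ (v ∷ʳ f)      ≡⟨ map-++ ∣_∣ˢ v [ f ] ⟩
    map ∣_∣ˢ v ∷ʳ ∣ f ∣ˢ   ↭⟨ ++⁺ʳ [ ∣ f ∣ˢ ] v∈ ⟩
    map ∣_∣ˢ w ∷ʳ ∣ f ∣ˢ   ≡⟨ map-++ ∣_∣ˢ w [ f ] ⟨
    map ∣_∣ˢ (w ∷ʳ f)      ↭⟨ w∈ ⟩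
    A                      ∎)
    where open PermutationReasoning

  ∈BP-starting-with : ∀ {A} h → ∣ h ∣ˢ ∈ A → ∃ λ y → h ∷ y ∈BP A
  ∈BP-starting-with h ∣h∣∈A with pre , post , refl ← ∈-∃++ ∣h∣∈A = y , abs↭ (begin
    ∣ h ∣ˢ ∷ map ∣_∣ˢ y  ≡⟨ cong (∣ h ∣ˢ ∷_) (trans (sym (map-∘ (pre ++ post))) (map-id (pre ++ post))) ⟩
    ∣ h ∣ˢ ∷ pre ++ post ↭⟨ shift ∣ h ∣ˢ pre post ⟨
    pre ++ [ ∣ h ∣ˢ ] ++ post ∎)
    where open PermutationReasoning
          y : List Letter
          y = map (false ,_) (pre ++ post)

  ∈BP-flipped : ∀ {A w} → w ∈BP A → flipped w ∈BP A
  ∈BP-flipped {w = w} (abs↭ w∈) = abs↭ (↭-trans (∣flipped∣↭ w) w∈)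

  ∈BP-flip-all : ∀ {A a r} → a ∷ r ∈BP A → flipped r ∷ʳ bar a ∈BP A
  ∈BP-flip-all {a = a} {r} a∷r∈ = subst (_∈BP _) (flipped-∷ a r) (∈BP-flipped a∷r∈)

  ∈BP-flip-all-bar : ∀ {A a r} → bar a ∷ r ∈BP A → flipped r ∷ʳ a ∈BP A
  ∈BP-flip-all-bar {a = a} {r} ā∷r∈ =
    subst (λ b → flipped r ∷ʳ b ∈BP _) (bar-involutive a) (∈BP-flip-all ā∷r∈)

  ∈BP-ending-with : ∀ {A} h → ∣ h ∣ˢ ∈ A → ∃ λ y → y ∷ʳ h ∈BP A
  ∈BP-ending-with h ∣h∣∈A with y , abs↭ h∷y∈ ← ∈BP-starting-with h ∣h∣∈A =
    y , abs↭ (begin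
      map ∣_∣ˢ (y ∷ʳ h)    ≡⟨ map-++ ∣_∣ˢ y [ h ] ⟩
      map ∣_∣ˢ y ∷ʳ ∣ h ∣ˢ ↭⟨ ∷↭∷ʳ ∣ h ∣ˢ (map ∣_∣ˢ y) ⟨
      ∣ h ∣ˢ ∷ map ∣_∣ˢ y  ↭⟨ h∷y∈ ⟩
      _                    ∎)
    where open PermutationReasoning

  ∈-cluster : ∀ {A w f a} → w ∷ʳ f ∈BP A → a ∈ A → a ≢ ∣ f ∣ˢ → a ∈ map ∣_∣ˢ w
  ∈-cluster {w = w} {f} (abs↭ w∈) a∈A a≢f
    with ∈-++⁻ (map ∣_∣ˢ w) (subst (_ ∈_) (map-++ ∣_∣ˢ w [ f ]) (∈-resp-↭ (↭-sym w∈) a∈A))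
  ... | inj₁ a∈w        = a∈w
  ... | inj₂ (here a≡f) = ⊥-elim (a≢f a≡f)

  unique-∷ʳ⁻ : ∀ (w : List Letter) f → Unique (map ∣_∣ˢ (w ∷ʳ f)) → Unique (map ∣_∣ˢ w)
  unique-∷ʳ⁻ w f u = subst Unique (take-length-++ (map ∣_∣ˢ w) [ ∣ f ∣ˢ ])
    (Unique.take⁺ (length (map ∣_∣ˢ w)) (subst Unique (map-++ ∣_∣ˢ w [ f ]) u))

  ∣first∣≢∣last∣ : ∀ (a : Letter) m l → Unique (map ∣_∣ˢ (a ∷ m ∷ʳ l)) → ∣ a ∣ˢ ≢ ∣ l ∣ˢ
  ∣first∣≢∣last∣ a m l u a≡l =
    Unique.Unique[x∷xs]⇒x∉xs u
      (subst (_∈ map ∣_∣ˢ (m ∷ʳ l)) (sym a≡l) (∈-map⁺ ∣_∣ˢ (∈-++⁺ʳ m (here refl))))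

  -- Unlike Walk, the reversal length is bounded by the length of the vertex, not by n,
  -- so paths live in BP on any alphabet.
  data Path (P : List Letter → Set) : List Letter → List Letter → Set where
    done : ∀ {u} → Path P u u
    step : ∀ {u w} i → 1 ≤ i → i ≤ length u → P (prefixRev i u) → Path P (prefixRev i u) w → Path P u w

  module _ {P : List Letter → Set} where

    infixr 5 _◅◅_

    _◅◅_ : ∀ {u v w} → Path P u v → Path P v w → Path P u w
    done                ◅◅ q = q
    step i 1≤i i≤u p r  ◅◅ q = step i 1≤i i≤u p (r ◅◅ q)

    edge : ∀ {u} i → 1 ≤ i → i ≤ length u → P (prefixRev i u) → Path P u (prefixRev i u)
    edge i 1≤i i≤u p = step i 1≤i i≤u p done

    flip-all : ∀ a r → P (flipped r ∷ʳ bar a) → Path P (a ∷ r) (flipped r ∷ʳ bar a)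
    flip-all a r p =
      subst (Path P (a ∷ r)) a∷r↦ (edge (length (a ∷ r)) (s≤s z≤n) ≤-refl (subst P (sym a∷r↦) p))
      where a∷r↦ : prefixRev (length (a ∷ r)) (a ∷ r) ≡ flipped r ∷ʳ bar a
            a∷r↦ = trans (prefixRev-all (a ∷ r)) (flipped-∷ a r)

    flip-all-bar : ∀ a r → P (flipped r ∷ʳ a) → Path P (bar a ∷ r) (flipped r ∷ʳ a)
    flip-all-bar a r p = subst (λ b → Path P (bar a ∷ r) (flipped r ∷ʳ b)) (bar-involutive a)
      (flip-all (bar a) r (subst (λ b → P (flipped r ∷ʳ b)) (sym (bar-involutive a)) p))

    Path-reverse : ∀ {u w} → Path P u w → P u → Path P w u
    Path-reverse done                 pu = done
    Path-reverse {u} (step i 1≤i i≤u p r) pu =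
      Path-reverse r p ◅◅ subst (Path P _) (prefixRev-involutive i u i≤u)
        (edge i 1≤i (≤-trans i≤u (≤-reflexive (sym (length-prefixRev i u))))
          (subst P (sym (prefixRev-involutive i u i≤u)) pu))

  Path-map : ∀ {P Q : List Letter → Set} {u w} → (∀ {y} → P y → Q y) → Path P u w → Path Q u w
  Path-map P⇒Q done                 = done
  Path-map P⇒Q (step i 1≤i i≤u p r) = step i 1≤i i≤u (P⇒Q p) (Path-map P⇒Q r)

  Path-∷ʳ : ∀ {P Q : List Letter → Set} {u w} f →
            (∀ {y} → P y → Q (y ∷ʳ f)) → Path P u w → Path Q (u ∷ʳ f) (w ∷ʳ f)
  Path-∷ʳ f P⇒Q done = done
  Path-∷ʳ {Q = Q} {u} f P⇒Q (step i 1≤i i≤u p r) =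
    step i 1≤i (≤-trans i≤u (length-++-≤ˡ u))
      (subst Q (sym (prefixRev-∷ʳ i u f i≤u)) (P⇒Q p))
      (subst (λ v → Path Q v _) (sym (prefixRev-∷ʳ i u f i≤u)) (Path-∷ʳ f P⇒Q r))

  Path⇒Walk : ∀ {P : List Letter → Set} {u w} →
              (∀ {y} → P y → length y ≡ n) → length u ≡ n → Path P u w → Walk n P u w
  Path⇒Walk ∣P∣≡n ∣u∣≡n done = done
  Path⇒Walk ∣P∣≡n ∣u∣≡n (step i 1≤i i≤u p r) =
    step (i , 1≤i , ≤-trans i≤u (≤-reflexive ∣u∣≡n) , refl) p (Path⇒Walk ∣P∣≡n (∣P∣≡n p) r)

  BPConnected : List (Fin n) → Set
  BPConnected A = ∀ {u v} → u ∈BP A → v ∈BP A → Path (_∈BP A) u v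

  IsLastOf : List Letter → List Letter → Letter → Set
  IsLastOf c d x = last c ≡ just x ⊎ last d ≡ just x

  record DeletablePair (c d : List Letter) : Set where
    field
      no-bar-pair    : ∀ {x} → IsLastOf c d x → ¬ IsLastOf c d (bar x)
      heads-not-last : ∀ {x} → head c ≡ just x ⊎ head d ≡ just x → ¬ IsLastOf c d x

  module WithoutPair
    {A : List (Fin n)} (A-unique : Unique A) {k} (∣A∣≡ : length A ≡ suc (suc k))
    (smaller-connected : ∀ {B} → length B ≡ suc k → Unique B → BPConnected B)
    (c d : List Letter) (pair : DeletablePair c d)
    where

    open DeletablePair pair

    Remaining : List Letter → Set
    Remaining y = y ∈BP A × y ≢ c × y ≢ d

    Clean : Letter → Set
    Clean f = ¬ IsLastOf c d f

    isLast? : ∀ x → Dec (IsLastOf c d x)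
    isLast? x = (last c ≟ₘ just x) ⊎-dec (last d ≟ₘ just x)
      where _≟ₘ_ : (p q : Maybe Letter) → Dec (p ≡ q)
            _≟ₘ_ = Maybe.≡-dec (Product.≡-dec Bool._≟_ Fin._≟_)

    clean-or-bar-clean : ∀ x → Clean x ⊎ Clean (bar x)
    clean-or-bar-clean x with isLast? x
    ... | no  x-clean = inj₁ x-clean
    ... | yes x-last  = inj₂ (no-bar-pair x-last)

    clean-cluster⊆ : ∀ {y f} → y ∷ʳ f ∈BP A → Clean f → Remaining (y ∷ʳ f)
    clean-cluster⊆ {y} {f} y∈ f-clean =
      y∈ , (λ y≡c → f-clean (inj₁ (last≡f y≡c))) , (λ y≡d → f-clean (inj₂ (last≡f y≡d)))
      where last≡f : ∀ {e} → y ∷ʳ f ≡ e → last e ≡ just f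
            last≡f refl = last-∷ʳ y f

    cluster-path : ∀ {w₁ w₂ f} → w₁ ∷ʳ f ∈BP A → w₂ ∷ʳ f ∈BP A → Clean f →
                   Path Remaining (w₁ ∷ʳ f) (w₂ ∷ʳ f)
    cluster-path {w₁} {w₂} {f} w₁∈ w₂∈ f-clean =
      Path-∷ʳ f (λ y∈ → clean-cluster⊆ (∈BP-∷ʳ⁺ y∈ w₁∈) f-clean)
        (smaller-connected ∣B∣ (unique-∷ʳ⁻ w₁ f (∈BP-unique w₁∈ A-unique)) (abs↭ ↭-refl) (∈BP-∷ʳ⁻ w₁∈ w₂∈))
      where ∣B∣ : length (map ∣_∣ˢ w₁) ≡ suc k
            ∣B∣ = trans (length-map ∣_∣ˢ w₁)
                    (suc-injective (trans (sym (length-∷ʳ w₁ f)) (trans (∈BP-length w₁∈) ∣A∣≡)))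

    last∈A : ∀ {w f} → w ∷ʳ f ∈BP A → ∣ f ∣ˢ ∈ A
    last∈A {w} (abs↭ w∈) = ∈-resp-↭ w∈ (∈-map⁺ ∣_∣ˢ (∈-++⁺ʳ w (here refl)))

    cluster-jump : ∀ {w₁ w₂ f g} → w₁ ∷ʳ f ∈BP A → w₂ ∷ʳ g ∈BP A → Clean f → Clean g →
                   ∣ f ∣ˢ ≢ ∣ g ∣ˢ → Path Remaining (w₁ ∷ʳ f) (w₂ ∷ʳ g)
    cluster-jump {w₁} {w₂} {f} {g} w₁∈ w₂∈ f-clean g-clean f≉g =
      cluster-path {w₂ = bar g ∷ y} w₁∈ z∈ f-clean
        ◅◅ flip-all-bar g (y ∷ʳ f) (clean-cluster⊆ z′∈ g-clean)
        ◅◅ cluster-path {w₁ = flipped (y ∷ʳ f)} z′∈ w₂∈ g-clean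
      where
      ḡ∷y : ∃ λ y → bar g ∷ y ∈BP map ∣_∣ˢ w₁
      ḡ∷y = ∈BP-starting-with (bar g)
              (∈-cluster {w = w₁} w₁∈ (last∈A {w = w₂} w₂∈) (λ g≡f → f≉g (sym g≡f)))
      y : List Letter
      y = proj₁ ḡ∷y
      z∈ : (bar g ∷ y) ∷ʳ f ∈BP A
      z∈ = ∈BP-∷ʳ⁺ {w = w₁} {v = bar g ∷ y} (proj₂ ḡ∷y) w₁∈
      z′∈ : flipped (y ∷ʳ f) ∷ʳ g ∈BP A
      z′∈ = ∈BP-flip-all-bar z∈

    too-short : ∀ {a} → ¬ (a ∷ [] ∈BP A)
    too-short a∈ with () ← trans (∈BP-length a∈) ∣A∣≡

    another-clean-letter : ∀ {w f} → w ∷ʳ f ∈BP A → ∃ λ h → Clean h × ∣ h ∣ˢ ∈ A × ∣ h ∣ˢ ≢ ∣ f ∣ˢ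
    another-clean-letter {[]}    w∈ = ⊥-elim (too-short w∈)
    another-clean-letter {a ∷ m} {f} w∈ = pick (clean-or-bar-clean a)
      where
      a∈A : ∣ a ∣ˢ ∈ A
      a∈A = ∈-resp-↭ (_∈BP_.∣w∣↭A w∈) (here refl)
      a≉f : ∣ a ∣ˢ ≢ ∣ f ∣ˢ
      a≉f = ∣first∣≢∣last∣ a m f (∈BP-unique w∈ A-unique)
      pick : Clean a ⊎ Clean (bar a) → ∃ λ h → Clean h × ∣ h ∣ˢ ∈ A × ∣ h ∣ˢ ≢ ∣ f ∣ˢ
      pick (inj₁ a-clean) = a     , a-clean , a∈A , a≉f
      pick (inj₂ ā-clean) = bar a , ā-clean , a∈A , a≉f

    clean-clusters-connected : ∀ {w₁ w₂ f₁ f₂} → w₁ ∷ʳ f₁ ∈BP A → w₂ ∷ʳ f₂ ∈BP A →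
                               Clean f₁ → Clean f₂ → Path Remaining (w₁ ∷ʳ f₁) (w₂ ∷ʳ f₂)
    clean-clusters-connected {w₁} {f₁ = f₁} {f₂} w₁∈ w₂∈ f₁-clean f₂-clean
      with ∣ f₁ ∣ˢ Fin.≟ ∣ f₂ ∣ˢ
    ... | no f₁≉f₂ = cluster-jump w₁∈ w₂∈ f₁-clean f₂-clean f₁≉f₂
    ... | yes f₁≈f₂
      with h , h-clean , h∈A , h≉f₁ ← another-clean-letter {w₁} w₁∈
      with y , y∈ ← ∈BP-ending-with h h∈A
      = cluster-jump {w₂ = y} w₁∈ y∈ f₁-clean h-clean (λ f₁≈h → h≉f₁ (sym f₁≈h))
        ◅◅ cluster-jump {w₁ = y} y∈ w₂∈ h-clean f₂-clean (λ h≈f₂ → h≉f₁ (trans h≈f₂ (sym f₁≈f₂)))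

    reach-clean-cluster : ∀ {u} → Remaining u →
                          ∃₂ λ w f → w ∷ʳ f ∈BP A × Clean f × Path Remaining u (w ∷ʳ f)
    reach-clean-cluster {[]} (u∈ , _) with () ← trans (∈BP-length u∈) ∣A∣≡
    reach-clean-cluster {a ∷ r} (u∈ , _) with isLast? (bar a)
    ... | no ā-clean = flipped r , bar a , v∈ , ā-clean , flip-all a r (clean-cluster⊆ v∈ ā-clean)
      where v∈ : flipped r ∷ʳ bar a ∈BP A
            v∈ = ∈BP-flip-all u∈
    ... | yes ā-last = flipped r , a , v∈ , a-clean ,
                       edge 1 (s≤s z≤n) (s≤s z≤n) ā∷r-rem ◅◅ flip-all-bar a r (clean-cluster⊆ v∈ a-clean)
      where
      a-clean : Clean a
      a-clean a-last = no-bar-pair a-last ā-last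
      ā∷r-rem : Remaining (bar a ∷ r)
      ā∷r-rem = ∈BP-prefixRev 1 u∈ ,
                (λ ā∷r≡c → heads-not-last (inj₁ (cong head (sym ā∷r≡c))) ā-last) ,
                (λ ā∷r≡d → heads-not-last (inj₂ (cong head (sym ā∷r≡d))) ā-last)
      v∈ : flipped r ∷ʳ a ∈BP A
      v∈ = ∈BP-flip-all-bar (proj₁ ā∷r-rem)

    remaining-connected : ∀ {u v} → Remaining u → Remaining v → Path Remaining u v
    remaining-connected u-rem v-rem
      with w₁ , f₁ , w₁∈ , f₁-clean , u↝ ← reach-clean-cluster u-rem
         | w₂ , f₂ , w₂∈ , f₂-clean , v↝ ← reach-clean-cluster v-rem
      = u↝ ◅◅ clean-clusters-connected w₁∈ w₂∈ f₁-clean f₂-clean ◅◅ Path-reverse v↝ v-rem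

  -- The empty list is not a vertex, so deleting it deletes nothing.
  nothing-deleted : DeletablePair [] []
  nothing-deleted = record
    { no-bar-pair    = λ { (inj₁ ()) ; (inj₂ ()) }
    ; heads-not-last = λ { (inj₁ ()) ; (inj₂ ()) }
    }

  singleton-vertex : ∀ {a u} → u ∈BP [ a ] → ∃ λ s → u ≡ [ s ] × ∣ s ∣ˢ ≡ a
  singleton-vertex {u = u} (abs↭ u∈) with u | ↭-singleton-inv u∈
  ... | s ∷ [] | refl = s , refl , refl

  single-letter-connected : ∀ {a} → BPConnected [ a ]
  single-letter-connected u∈ v∈
    with s , refl , refl ← singleton-vertex u∈
       | t , refl , ∣t∣≡∣s∣ ← singleton-vertex v∈
    with ∣∣≡⇒≡⊎≡bar {s} {t} (sym ∣t∣≡∣s∣)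
  ... | inj₁ refl = done
  ... | inj₂ refl = edge 1 (s≤s z≤n) (s≤s z≤n) v∈

  BP-connected : ∀ k {A} → length A ≡ suc k → Unique A → BPConnected A
  BP-connected zero    {_ ∷ []} refl _ = single-letter-connected
  BP-connected (suc k) {A} ∣A∣≡ A-unique u∈ v∈ =
    Path-map proj₁ (remaining-connected (remains u∈) (remains v∈))
    where
    open WithoutPair A-unique ∣A∣≡ (BP-connected k) [] [] nothing-deleted
    remains : ∀ {w} → w ∈BP A → Remaining w
    remains {w} w∈ = w∈ , nonempty , nonempty
      where nonempty : w ≢ []
            nonempty refl with () ← trans (∈BP-length w∈) ∣A∣≡

  head≢last : ∀ w l {h} → 1 ≤ length w → Unique (map ∣_∣ˢ (w ∷ʳ l)) → head (w ∷ʳ l) ≡ just h → h ≢ l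
  head≢last (a ∷ m) l _ u refl a≡l = ∣first∣≢∣last∣ a m l u (cong ∣_∣ˢ a≡l)

  short-prefixRev-deletable : ∀ i c l → 1 ≤ i → i ≤ length c → Unique (map ∣_∣ˢ (c ∷ʳ l)) →
                              DeletablePair (c ∷ʳ l) (prefixRev i c ∷ʳ l)
  short-prefixRev-deletable i c l 1≤i i≤∣c∣ c-unique = record
    { no-bar-pair    = λ ℓx ℓx̄ → bar≢ _ (trans (is-l ℓx̄) (sym (is-l ℓx)))
    ; heads-not-last = λ { (inj₁ hc) ℓx → head≢last c l 1≤∣c∣ c-unique hc (is-l ℓx)
                         ; (inj₂ hd) ℓx → head≢last d l 1≤∣d∣ d-unique hd (is-l ℓx) }
    }
    where
    d : List Letter
    d = prefixRev i c
    1≤∣c∣ : 1 ≤ length c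
    1≤∣c∣ = ≤-trans 1≤i i≤∣c∣
    1≤∣d∣ : 1 ≤ length d
    1≤∣d∣ = subst (1 ≤_) (sym (length-prefixRev i c)) 1≤∣c∣
    d-unique : Unique (map ∣_∣ˢ (d ∷ʳ l))
    d-unique = ∈BP-unique (∈BP-∷ʳ⁺ {w = c} (abs↭ (∣prefixRev∣↭ i c)) (abs↭ ↭-refl)) c-unique
    is-l : ∀ {x} → IsLastOf (c ∷ʳ l) (d ∷ʳ l) x → x ≡ l
    is-l (inj₁ ℓx) = last-∷ʳ⁻ c ℓx
    is-l (inj₂ ℓx) = last-∷ʳ⁻ d ℓx

  flipped-∷-∷ʳ : ∀ a m l → flipped (a ∷ m ∷ʳ l) ≡ bar l ∷ flipped m ∷ʳ bar a
  flipped-∷-∷ʳ a m l =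
    trans (flipped-∷ a (m ∷ʳ l)) (cong (λ r → map bar r ∷ʳ bar a) (reverse-++ m [ l ]))

  flipped-deletable : ∀ c → 2 ≤ length c → Unique (map ∣_∣ˢ c) → DeletablePair c (flipped c)
  flipped-deletable (a ∷ c) 2≤∣c∣ c-unique with initLast c
  ... | []      with s≤s () ← 2≤∣c∣
  ... | m ∷ʳ′ l = subst (DeletablePair (a ∷ m ∷ʳ l)) (sym (flipped-∷-∷ʳ a m l)) (record
    { no-bar-pair    = λ ℓx ℓx̄ → no-bar-pair (is-last ℓx) (is-last ℓx̄)
    ; heads-not-last = λ h ℓx → heads-not-last h (is-last ℓx)
    })
    where
    a≉l : ∣ a ∣ˢ ≢ ∣ l ∣ˢ
    a≉l = ∣first∣≢∣last∣ a m l c-unique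
    is-last : ∀ {x} → IsLastOf (a ∷ m ∷ʳ l) (bar l ∷ flipped m ∷ʳ bar a) x → x ≡ l ⊎ x ≡ bar a
    is-last (inj₁ ℓx) = inj₁ (last-∷ʳ⁻ (a ∷ m) ℓx)
    is-last (inj₂ ℓx) = inj₂ (last-∷ʳ⁻ (bar l ∷ flipped m) ℓx)
    no-bar-pair : ∀ {x} → x ≡ l ⊎ x ≡ bar a → ¬ (bar x ≡ l ⊎ bar x ≡ bar a)
    no-bar-pair (inj₁ refl) (inj₁ l̄≡l) = bar≢ l l̄≡l
    no-bar-pair (inj₁ refl) (inj₂ l̄≡ā) = a≉l (sym (cong ∣_∣ˢ l̄≡ā))
    no-bar-pair (inj₂ refl) (inj₁ a≡l) = a≉l (cong ∣_∣ˢ a≡l)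
    no-bar-pair (inj₂ refl) (inj₂ a≡ā) = bar≢ (bar a) a≡ā
    heads-not-last : ∀ {x} → head (a ∷ m ∷ʳ l) ≡ just x ⊎ head (bar l ∷ flipped m ∷ʳ bar a) ≡ just x →
                     ¬ (x ≡ l ⊎ x ≡ bar a)
    heads-not-last (inj₁ refl) (inj₁ a≡l) = a≉l (cong ∣_∣ˢ a≡l)
    heads-not-last (inj₁ refl) (inj₂ a≡ā) = bar≢ a (sym a≡ā)
    heads-not-last (inj₂ refl) (inj₁ l̄≡l) = bar≢ l l̄≡l
    heads-not-last (inj₂ refl) (inj₂ l̄≡ā) = a≉l (sym (cong ∣_∣ˢ l̄≡ā))

  prefixRev-deletable : ∀ i c → 1 ≤ i → i ≤ length c → 2 ≤ length c → Unique (map ∣_∣ˢ c) →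
                        DeletablePair c (prefixRev i c)
  prefixRev-deletable i c 1≤i i≤∣c∣ 2≤∣c∣ c-unique with m≤n⇒m<n∨m≡n i≤∣c∣
  ... | inj₂ refl = subst (DeletablePair c) (sym (prefixRev-all c)) (flipped-deletable c 2≤∣c∣ c-unique)
  ... | inj₁ i<∣c∣ with initLast c
  ... | c′ ∷ʳ′ l = subst (DeletablePair (c′ ∷ʳ l)) (sym (prefixRev-∷ʳ i c′ l i≤∣c′∣))
                     (short-prefixRev-deletable i c′ l 1≤i i≤∣c′∣ c-unique)
    where i≤∣c′∣ : i ≤ length c′
          i≤∣c′∣ = s≤s⁻¹ (subst (suc i ≤_) (length-∷ʳ c′ l) i<∣c∣)

  ends-with : ∀ {j} (w : List Letter) → last w ≡ just j → ∃ λ w′ → w ≡ w′ ∷ʳ j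
  ends-with w w-last with initLast w
  ... | w′ ∷ʳ′ x with refl ← last-∷ʳ⁻ w′ w-last = w′ , refl

  vertex-length : ∀ {w} → IsSignedPerm n w → length w ≡ n
  vertex-length w-perm = trans (∈BP-length (abs↭ w-perm)) (length-tabulate id)

  cluster-minus-connected : ∀ k {j} x′ i → IsSignedPerm n (x′ ∷ʳ j) → length x′ ≡ suc (suc k) →
                            1 ≤ i → i ≤ length x′ → InducedConnected n (ClusterMinus n j (x′ ∷ʳ j) i)
  cluster-minus-connected k {j} x′ i x-perm ∣x′∣≡ 1≤i i≤∣x′∣ _ _ = connect
    where
    x∈ : x′ ∷ʳ j ∈BP allFin n
    x∈ = abs↭ x-perm
    A-unique : Unique (map ∣_∣ˢ x′)
    A-unique = unique-∷ʳ⁻ x′ j (∈BP-unique x∈ (Unique.allFin⁺ n))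
    open WithoutPair A-unique (trans (length-map ∣_∣ˢ x′) ∣x′∣≡) (BP-connected k) x′ (prefixRev i x′)
           (prefixRev-deletable i x′ 1≤i i≤∣x′∣ (subst (2 ≤_) (sym ∣x′∣≡) (s≤s (s≤s z≤n))) A-unique)
    x⟨i⟩ : prefixRev i (x′ ∷ʳ j) ≡ prefixRev i x′ ∷ʳ j
    x⟨i⟩ = prefixRev-∷ʳ i x′ j i≤∣x′∣
    to-remaining : ∀ {w} → ClusterMinus n j (x′ ∷ʳ j) i w → ∃ λ w′ → w ≡ w′ ∷ʳ j × Remaining w′
    to-remaining {w} ((w-perm , w-last) , w≢x , w≢x⟨i⟩) with w′ , refl ← ends-with w w-last =
      w′ , refl , ∈BP-∷ʳ⁻ {w = x′} x∈ (abs↭ w-perm) ,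
      (λ { refl → w≢x refl }) , (λ { refl → w≢x⟨i⟩ (sym x⟨i⟩) })
    from-remaining : ∀ {y} → Remaining y → ClusterMinus n j (x′ ∷ʳ j) i (y ∷ʳ j)
    from-remaining {y} (y∈ , y≢x′ , y≢x′⟨i⟩) =
      (_∈BP_.∣w∣↭A (∈BP-∷ʳ⁺ {w = x′} y∈ x∈) , last-∷ʳ y j) ,
      (λ e → y≢x′ (∷ʳ-injectiveˡ y x′ e)) ,
      (λ e → y≢x′⟨i⟩ (∷ʳ-injectiveˡ y (prefixRev i x′) (trans e x⟨i⟩)))
    connect : ∀ {u v} → ClusterMinus n j (x′ ∷ʳ j) i u → ClusterMinus n j (x′ ∷ʳ j) i v →
              Walk n (ClusterMinus n j (x′ ∷ʳ j) i) u v
    connect u∈ v∈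
      with u′ , refl , u′-rem ← to-remaining u∈
         | v′ , refl , v′-rem ← to-remaining v∈
      = Path⇒Walk (λ w∈ → vertex-length (proj₁ (proj₁ w∈))) (vertex-length (proj₁ (proj₁ u∈)))
          (Path-∷ʳ j from-remaining (remaining-connected u′-rem v′-rem))

lemma3p3 : (n : ℕ) → 3 ≤ n → (j : Signed n) → (x : List (Signed n)) →
    InCluster n j x → (i : ℕ) → 1 ≤ i → i ≤ n ∸ 1 →
    InducedConnected n (ClusterMinus n j x i)
lemma3p3 _ (s≤s (s≤s (s≤s {n = k} _))) j x (x-perm , x-last) i 1≤i i≤n-1
  with x′ , refl ← ends-with x x-last =
  cluster-minus-connected k x′ i x-perm ∣x′∣≡ 1≤i (subst (i ≤_) (sym ∣x′∣≡) i≤n-1)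
  where ∣x′∣≡ : length x′ ≡ suc (suc k)
        ∣x′∣≡ = suc-injective (trans (sym (length-∷ʳ x′ j)) (vertex-length x-perm))
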